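{- For $n\geq 2$, call a set $\{x_1,\dots,x_n\}$ of $n$ pairwise distinct positive integers admissible if $\sum_{i=1}^n 1/x_i=1$ and there is an odd prime $q$ such that every $x_i$ is of the form $2^{a_i}q^{b_i}$ with $a_i\in\{0,1,2\}$, $b_i\geq 0$. For $n=10,11,12,13$ the number of admissible sets is respectively $101$, $192$, $363$, $692$. Of these, respectively $100$, $190$, $362$, $690$ have $q=3$. The remaining ones are: for each $n\in\{10,11,12,13\}$ the set $U_n=\{2,2^2,5,5^2,\dots,5^{n-3},2^2\cdot 5^{n-3}\}$ (with $q=5$), and, for $n\in\{11,13\}$ only, the set $V_n=\{2,2^2,7,2\cdot 7,7^2,2\cdot 7^2,\dots,7^{\frac{n-5}{2}},2\cdot 7^{\frac{n-5}{2}},7^{\frac{n-3}{2}},2\cdot 7^{\frac{n-3}{2}},2^2\cdot 7^{\frac{n-3}{2}}\}$ (with $q=7$).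
   Context: Solutions are counted as unordered sets; the same odd prime $q$ is used for all entries of a given set. -}

module Defs where

open import Data.Nat using (ℕ; zero; suc; _+_; _*_; _∸_; _^_; _≤_; _<_; _%_; _/_)
open import Data.Nat.Primality using (Prime)
open import Data.Integer using (+_)
open import Data.Rational using (ℚ; 0ℚ; 1ℚ) renaming (_+_ to _+ℚ_; _/_ to _/ℚ_)
open import Data.List using (List; []; _∷_; _++_; length; map; concatMap; upTo)
open import Data.List.Relation.Unary.All using (All)
open import Data.List.Relation.Unary.Linked using (Linked)
open import Data.List.Relation.Unary.Unique.Propositional using (Unique)
open import Data.List.Membership.Propositional using (_∈_)
open import Data.Product using (Σ; ∃; _×_)
open import Data.Sum using (_⊎_)
open import Relation.Binary.PropositionalEquality using (_≡_; _≢_)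
open import Relation.Nullary using (¬_)
open import Function.Bundles using (_⇔_)
open import Data.Bool using (Bool; true; false; if_then_else_)
open import Data.Unit using (⊤)
open import Data.Empty using (⊥)

-- A finite set of positive integers is represented by the list of its
-- elements in strictly increasing order (so the representation is unique
-- and the elements are pairwise distinct; the cardinality is the length).

-- Sum of reciprocals 1/x over the list (a zero entry contributes 0;
-- entries are positive anyway by the shape condition below).
recipSum : List ℕ → ℚ
recipSum [] = 0ℚ
recipSum (zero ∷ xs) = recipSum xs
recipSum (suc k ∷ xs) = ((+ 1) /ℚ suc k) +ℚ recipSum xs

Shape : ℕ → ℕ → Set
Shape q x = Σ ℕ λ a → Σ ℕ λ b → a ≤ 2 × x ≡ 2 ^ a * q ^ b

AdmissibleWith : ℕ → ℕ → List ℕ → Set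
AdmissibleWith q n S =
  length S ≡ n × Linked _<_ S × recipSum S ≡ 1ℚ ×
  Prime q × q % 2 ≡ 1 × All (Shape q) S

Admissible : ℕ → List ℕ → Set
Admissible n S = ∃ λ q → AdmissibleWith q n S

range : ℕ → ℕ → List ℕ
range a k = map (λ i → a + i) (upTo k)

U : ℕ → List ℕ
U n = 2 ∷ 4 ∷ (map (5 ^_) (range 1 (n ∸ 3)) ++ (4 * 5 ^ (n ∸ 3) ∷ []))

V : ℕ → List ℕ
V n = 2 ∷ 4 ∷ (concatMap (λ k → 7 ^ k ∷ 2 * 7 ^ k ∷ []) (range 1 ((n ∸ 5) / 2))
               ++ (7 ^ m ∷ 2 * 7 ^ m ∷ 4 * 7 ^ m ∷ []))
  where m = (n ∸ 3) / 2

Claim : ℕ → ℕ → ℕ → Bool → Set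
Claim n total with3 hasV =
  (Σ (List (List ℕ)) λ L → length L ≡ total × Unique L × (∀ S → (S ∈ L) ⇔ Admissible n S)) ×
  (Σ (List (List ℕ)) λ L → length L ≡ with3 × Unique L × (∀ S → (S ∈ L) ⇔ AdmissibleWith 3 n S)) ×
  Admissible n (U n) ×
  (if hasV then Admissible n (V n) else ⊤) ×
  (∀ S → Admissible n S → ¬ AdmissibleWith 3 n S → S ≡ U n ⊎ (if hasV then S ≡ V n else ⊥))

{-# OPTIONS --safe #-}

-- For q ≥ 8 the numbers 2^a q^b with a ≤ 2, taken in increasing order, at least
-- double from one to the next, so their reciprocals sum to less than 2/x for the
-- least one x; a sum equal to 1 then forces x = 1, and nothing else fits.  Hence
-- only q ∈ {3, 5, 7} occur.  For these the sets are enumerated by a search: if x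
-- is the least of k terms whose reciprocals sum to p/d, then 1/x ≤ p/d ≤ k/x,
-- leaving finitely many choices for x.  The search is sound, complete and
-- duplicate-free, so the counts and the exceptional sets are read off by
-- evaluating it.

module Submission where

open import Data.Nat
open import Data.Nat.Properties
open import Data.Bool using (Bool; true; false; if_then_else_)
open import Data.Empty using (⊥; ⊥-elim)
open import Data.Integer as ℤ using (+_)
import Data.Integer.Properties as ℤ
open import Data.List using (List; []; _∷_; _++_; length; map; concatMap; filter; deduplicate)
open import Data.List.Properties using (∷-injective; ∷-injectiveʳ)
open import Data.List.Membership.Propositional using (_∈_; find; lose)
open import Data.List.Membership.Propositional.Properties
  using (∈-map⁺; ∈-map⁻; ∈-concatMap⁺; ∈-concatMap⁻; ∈-filter⁺; ∈-filter⁻;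
         ∈-deduplicate⁺; ∈-deduplicate⁻; ∈-++⁺ˡ; ∈-++⁺ʳ; ∈-++⁻)
open import Data.List.Membership.DecPropositional _≟_ using (_∈?_)
open import Data.List.Relation.Binary.Disjoint.Propositional using (Disjoint)
open import Data.List.Relation.Unary.All as All using (All; []; _∷_; lookup)
import Data.List.Relation.Unary.All.Properties as All
import Data.List.Relation.Unary.AllPairs as AllPairs
import Data.List.Relation.Unary.AllPairs.Properties as AllPairs
open import Data.List.Relation.Unary.Any using (here; there)
open import Data.List.Relation.Unary.Linked as Linked using (Linked; []; [-]; _∷_)
open import Data.List.Relation.Unary.Linked.Properties using (Linked⇒All)
open import Data.List.Relation.Unary.Unique.Propositional using (Unique)
open import Data.List.Relation.Unary.Unique.Propositional.Properties using (++⁺; concat⁺)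
import Data.List.Relation.Unary.Unique.Propositional.Properties as Unique
open import Data.List.Relation.Unary.Unique.DecPropositional.Properties _≟_ using (deduplicate-!)
open import Data.Nat.DivMod using (m*n/n≡m; /-monoˡ-≤)
open import Data.Nat.Primality using (Prime; prime?; ¬prime[1]; prime⇒nonTrivial)
open import Data.Nat.Tactic.RingSolver using (solve-∀)
open import Data.Product using (_×_; _,_; ∃₂; proj₁; proj₂)
open import Data.Rational as ℚ using (1ℚ; toℚᵘ)
import Data.Rational.Properties as ℚ
open import Data.Rational.Unnormalised as ℚᵘ using (ℚᵘ; mkℚᵘ; 1ℚᵘ; _≃_; *≡*)
import Data.Rational.Unnormalised.Properties as ℚᵘ
open import Data.Sum using (_⊎_; inj₁; inj₂)
open import Data.Unit using (⊤; tt)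
open import Function.Bundles using (_⇔_; mk⇔; Equivalence)
open import Relation.Binary.Definitions using (tri<; tri≈; tri>)
open import Relation.Binary.PropositionalEquality
open import Relation.Nullary using (¬_; Dec; yes; no)
open import Relation.Nullary.Decidable using (_×-dec_; map′; from-yes; from-no)

open import Defs

open Equivalence using (to; from)

-- recipSum xs = recipNumerator xs / recipDenominator xs, unreduced: the
-- denominator is the product of the nonzero entries.
recipDenominator-1 : List ℕ → ℕ
recipDenominator-1 [] = 0
recipDenominator-1 (zero ∷ xs) = recipDenominator-1 xs
recipDenominator-1 (suc k ∷ xs) = recipDenominator-1 xs + k * suc (recipDenominator-1 xs)

recipDenominator : List ℕ → ℕ
recipDenominator xs = suc (recipDenominator-1 xs)

recipNumerator : List ℕ → ℕ
recipNumerator [] = 0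
recipNumerator (zero ∷ xs) = recipNumerator xs
recipNumerator (suc k ∷ xs) = recipDenominator xs + recipNumerator xs * suc k

recipNumerator-∷ : ∀ {x} xs → 0 < x →
  recipNumerator (x ∷ xs) ≡ recipDenominator xs + recipNumerator xs * x
recipNumerator-∷ {suc _} _ _ = refl

recipDenominator-∷ : ∀ {x} xs → 0 < x → recipDenominator (x ∷ xs) ≡ x * recipDenominator xs
recipDenominator-∷ {suc _} _ _ = refl

recipNumerator-pos : ∀ {x} xs → 0 < x → 0 < recipNumerator (x ∷ xs)
recipNumerator-pos {suc _} _ _ = s≤s z≤n

recipSumᵘ : List ℕ → ℚᵘ
recipSumᵘ xs = mkℚᵘ (+ recipNumerator xs) (recipDenominator-1 xs)

recipSumᵘ-∷ : ∀ k xs → mkℚᵘ (+ 1) k ℚᵘ.+ recipSumᵘ xs ≃ recipSumᵘ (suc k ∷ xs)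
recipSumᵘ-∷ k xs =
  ℚᵘ.≃-reflexive (cong (λ z → mkℚᵘ z (recipDenominator-1 (suc k ∷ xs))) numerator)
  where
  open ≡-Reasoning
  D = recipDenominator xs
  N = recipNumerator xs
  numerator : + 1 ℤ.* + D ℤ.+ + N ℤ.* + suc k ≡ + (D + N * suc k)
  numerator = begin
    + 1 ℤ.* + D ℤ.+ + N ℤ.* + suc k
      ≡⟨ cong₂ ℤ._+_ (ℤ.*-identityˡ (+ D)) (sym (ℤ.pos-* N (suc k))) ⟩
    + D ℤ.+ + (N * suc k)
      ≡⟨ ℤ.pos-+ D (N * suc k) ⟨
    + (D + N * suc k) ∎

toℚᵘ-recipSum : ∀ xs → toℚᵘ (recipSum xs) ≃ recipSumᵘ xs
toℚᵘ-recipSum [] = *≡* refl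
toℚᵘ-recipSum (zero ∷ xs) = toℚᵘ-recipSum xs
toℚᵘ-recipSum (suc k ∷ xs) = begin
  toℚᵘ (recipSum (suc k ∷ xs))
    ≈⟨ ℚ.toℚᵘ-homo-+ (+ 1 ℚ./ suc k) (recipSum xs) ⟩
  toℚᵘ (+ 1 ℚ./ suc k) ℚᵘ.+ toℚᵘ (recipSum xs)
    ≈⟨ ℚᵘ.+-cong (ℚ.toℚᵘ-fromℚᵘ (mkℚᵘ (+ 1) k)) (toℚᵘ-recipSum xs) ⟩
  mkℚᵘ (+ 1) k ℚᵘ.+ recipSumᵘ xs
    ≈⟨ recipSumᵘ-∷ k xs ⟩
  recipSumᵘ (suc k ∷ xs) ∎
  where open ℚᵘ.≃-Reasoning

recipSumᵘ≃1⇔ : ∀ xs → recipSumᵘ xs ≃ 1ℚᵘ ⇔ recipNumerator xs ≡ recipDenominator xs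
recipSumᵘ≃1⇔ xs = mk⇔
  (λ { (*≡* eq) → ℤ.+-injective (trans (sym (ℤ.*-identityʳ _)) (trans eq (ℤ.*-identityˡ _))) })
  (λ eq → *≡* (trans (ℤ.*-identityʳ _) (trans (cong +_ eq) (sym (ℤ.*-identityˡ _)))))

recipSum≡1⇔ : ∀ xs → recipSum xs ≡ 1ℚ ⇔ recipNumerator xs ≡ recipDenominator xs
recipSum≡1⇔ xs = mk⇔
  (λ eq → to (recipSumᵘ≃1⇔ xs) (ℚᵘ.≃-trans (ℚᵘ.≃-sym (toℚᵘ-recipSum xs)) (ℚ.toℚᵘ-cong eq)))
  (λ eq → ℚ.toℚᵘ-injective (ℚᵘ.≃-trans (toℚᵘ-recipSum xs) (from (recipSumᵘ≃1⇔ xs) eq)))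

recipSum-∷-≡⇔ : ∀ {x} p d ys → 0 < x → d ≤ p * x →
  recipNumerator (x ∷ ys) * d ≡ p * recipDenominator (x ∷ ys) ⇔
  recipNumerator ys * (d * x) ≡ (p * x ∸ d) * recipDenominator ys
recipSum-∷-≡⇔ {x} p d ys 0<x d≤px = mk⇔
  (λ eq → +-cancelˡ-≡ (d * D) _ _ (trans (sym lhs) (trans eq rhs)))
  (λ eq → trans lhs (trans (cong (_+_ (d * D)) eq) (sym rhs)))
  where
  open ≡-Reasoning
  N = recipNumerator ys
  D = recipDenominator ys
  distrib : ∀ D N x d → (D + N * x) * d ≡ d * D + N * (d * x)
  distrib = solve-∀
  lhs : recipNumerator (x ∷ ys) * d ≡ d * D + N * (d * x)
  lhs = trans (cong (_* d) (recipNumerator-∷ ys 0<x)) (distrib D N x d)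
  rhs : p * recipDenominator (x ∷ ys) ≡ d * D + (p * x ∸ d) * D
  rhs = begin
    p * recipDenominator (x ∷ ys) ≡⟨ cong (p *_) (recipDenominator-∷ ys 0<x) ⟩
    p * (x * D)                   ≡⟨ *-assoc p x D ⟨
    p * x * D                     ≡⟨ cong (_* D) (m+[n∸m]≡n d≤px) ⟨
    (d + (p * x ∸ d)) * D         ≡⟨ *-distribʳ-+ D d (p * x ∸ d) ⟩
    d * D + (p * x ∸ d) * D       ∎

recipSum-∷-lower : ∀ {x} p d ys → 0 < x →
  recipNumerator (x ∷ ys) * d ≡ p * recipDenominator (x ∷ ys) → d ≤ p * x
recipSum-∷-lower {x} p d ys 0<x eq = *-cancelʳ-≤ d (p * x) D (begin
  d * D                          ≡⟨ *-comm d D ⟩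
  D * d                          ≤⟨ *-monoˡ-≤ d (m≤m+n D (N * x)) ⟩
  (D + N * x) * d                ≡⟨ cong (_* d) (recipNumerator-∷ ys 0<x) ⟨
  recipNumerator (x ∷ ys) * d    ≡⟨ eq ⟩
  p * recipDenominator (x ∷ ys)  ≡⟨ cong (p *_) (recipDenominator-∷ ys 0<x) ⟩
  p * (x * D)                    ≡⟨ *-assoc p x D ⟨
  p * x * D                      ∎)
  where
  open ≤-Reasoning
  N = recipNumerator ys
  D = recipDenominator ys

recipSum≤length/x : ∀ {x} xs → 0 < x → All (x ≤_) xs →
  recipNumerator xs * x ≤ length xs * recipDenominator xs
recipSum≤length/x [] _ [] = z≤n
recipSum≤length/x {x} (y ∷ ys) 0<x (x≤y ∷ x≤ys) = begin
  recipNumerator (y ∷ ys) * x          ≡⟨ cong (_* x) (recipNumerator-∷ ys 0<y) ⟩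
  (D + N * y) * x                      ≡⟨ distrib D N x y ⟩
  D * x + N * x * y                    ≤⟨ +-mono-≤ (*-monoʳ-≤ D x≤y) (*-monoˡ-≤ y ih) ⟩
  D * y + length ys * D * y            ≡⟨ collect D y (length ys) ⟩
  suc (length ys) * (y * D)            ≡⟨ cong (suc (length ys) *_) (recipDenominator-∷ ys 0<y) ⟨
  suc (length ys) * recipDenominator (y ∷ ys) ∎
  where
  open ≤-Reasoning
  N = recipNumerator ys
  D = recipDenominator ys
  0<y = <-≤-trans 0<x x≤y
  ih = recipSum≤length/x ys 0<x x≤ys
  distrib : ∀ D N x y → (D + N * y) * x ≡ D * x + N * x * y
  distrib = solve-∀
  collect : ∀ D y L → D * y + L * D * y ≡ suc L * (y * D)
  collect = solve-∀

recipSum-∷-upper : ∀ {x} p d ys → 0 < x → Linked _<_ (x ∷ ys) →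
  recipNumerator (x ∷ ys) * d ≡ p * recipDenominator (x ∷ ys) → p * x ≤ length (x ∷ ys) * d
recipSum-∷-upper {x} p d ys 0<x lk eq = *-cancelʳ-≤ (p * x) (L * d) D (begin
  p * x * D   ≡⟨ swap p x D ⟩
  p * D * x   ≡⟨ cong (_* x) eq ⟨
  N * d * x   ≡⟨ swap N d x ⟩
  N * x * d   ≤⟨ *-monoˡ-≤ d (recipSum≤length/x (x ∷ ys) 0<x x≤xys) ⟩
  L * D * d   ≡⟨ swap L D d ⟩
  L * d * D   ∎)
  where
  open ≤-Reasoning
  N = recipNumerator (x ∷ ys)
  D = recipDenominator (x ∷ ys)
  L = length (x ∷ ys)
  x≤xys : All (x ≤_) (x ∷ ys)
  x≤xys = Linked⇒All ≤-trans ≤-refl (Linked.map <⇒≤ lk)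
  swap : ∀ a b c → a * b * c ≡ a * c * b
  swap = solve-∀

module _ {a} {A : Set a} where

  branch : List A → (A → List (List A)) → List (List A)
  branch cs f = concatMap (λ c → map (c ∷_) (f c)) cs

  ∈-branch⁺ : ∀ {cs f x ys} → x ∈ cs → ys ∈ f x → x ∷ ys ∈ branch cs f
  ∈-branch⁺ x∈cs ys∈fx = ∈-concatMap⁺ _ (lose x∈cs (∈-map⁺ _ ys∈fx))

  ∈-branch⁻ : ∀ cs f {xs} → xs ∈ branch cs f →
              ∃₂ λ x ys → xs ≡ x ∷ ys × x ∈ cs × ys ∈ f x
  ∈-branch⁻ cs f m with find (∈-concatMap⁻ _ {xs = cs} m)
  ... | c , c∈cs , m′ with ∈-map⁻ (c ∷_) m′
  ... | ys , ys∈fc , eq = c , ys , eq , c∈cs , ys∈fc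

  branch-unique : ∀ {cs f} → Unique cs → (∀ c → Unique (f c)) → Unique (branch cs f)
  branch-unique {cs} {f} cs! f! =
    concat⁺ (All.map⁺ (All.tabulate (λ {c} _ → Unique.map⁺ ∷-injectiveʳ (f! c))))
            (AllPairs.map⁺ (AllPairs.map disjoint cs!))
    where
    disjoint : ∀ {c c′} → c ≢ c′ → Disjoint (map (c ∷_) (f c)) (map (c′ ∷_) (f c′))
    disjoint c≢c′ (m , m′) with ∈-map⁻ _ m | ∈-map⁻ _ m′
    ... | _ , _ , refl | _ , _ , eq = c≢c′ (proj₁ (∷-injective eq))

n<m^n : ∀ {m} n → 2 ≤ m → n < m ^ n
n<m^n zero _ = s≤s z≤n
n<m^n {m} (suc n) 2≤m =
  ≤-trans (s≤s (n<m^n n 2≤m)) (subst (m ^ n <_) (*-comm (m ^ n) m) (m<m*n (m ^ n) m 2≤m))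
  where instance _ = m^n≢0 m n {{>-nonZero (<-≤-trans (s≤s z≤n) 2≤m)}}

shape⇒pos : ∀ {q x} .{{_ : NonZero q}} → Shape q x → 0 < x
shape⇒pos {q} (a , b , _ , refl) = *-mono-< (m^n>0 2 a) (m^n>0 q b)

∈-powersOf2* : ∀ {a t xs} → a ≤ 2 → 2 ^ a * t ∈ 2 ^ 0 * t ∷ 2 ^ 1 * t ∷ 2 ^ 2 * t ∷ xs
∈-powersOf2* z≤n = here refl
∈-powersOf2* (s≤s z≤n) = there (here refl)
∈-powersOf2* (s≤s (s≤s z≤n)) = there (there (here refl))

module Search (q : ℕ) where

  -- 2^a q^e for a ≤ 2 and e ≥ b with q^e ≤ M (so also some shapes above M), trying at most
  -- fuel exponents
  shapesFrom : ℕ → ℕ → ℕ → List ℕ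
  shapesFrom zero b M = []
  shapesFrom (suc fuel) b M with q ^ b ≤? M
  ... | yes _ = 2 ^ 0 * q ^ b ∷ 2 ^ 1 * q ^ b ∷ 2 ^ 2 * q ^ b ∷ shapesFrom fuel (suc b) M
  ... | no _ = []

  shapesUpTo : ℕ → List ℕ
  shapesUpTo M = shapesFrom (suc M) 0 M

  -- x can be the least of k increasing terms whose reciprocals sum to p/d: 1/x ≤ p/d ≤ k/x
  FeasibleHead : ℕ → ℕ → ℕ → ℕ → ℕ → Set
  FeasibleHead k lo p d x = lo < x × d ≤ p * x × p * x ≤ k * d

  feasibleHead? : ∀ k lo p d x → Dec (FeasibleHead k lo p d x)
  feasibleHead? k lo p d x = lo <? x ×-dec d ≤? p * x ×-dec p * x ≤? k * d

  headBound : ℕ → ℕ → ℕ → ℕ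
  headBound k zero d = 0
  headBound k (suc p) d = k * d / suc p

  candidates : ℕ → ℕ → ℕ → ℕ → List ℕ
  candidates k lo p d =
    deduplicate _≟_ (filter (feasibleHead? k lo p d) (shapesUpTo (headBound k p d)))

  -- once the least term x is chosen, the others must sum to p/d − 1/x = (p x − d)/(d x)
  expansions : ℕ → ℕ → ℕ → ℕ → List (List ℕ)
  expansions zero lo zero d = [] ∷ []
  expansions zero lo (suc p) d = []
  expansions (suc k) lo p d =
    branch (candidates (suc k) lo p d) (λ x → expansions k x (p * x ∸ d) (d * x))

  Expansion : ℕ → ℕ → ℕ → ℕ → List ℕ → Set
  Expansion k lo p d xs =
    length xs ≡ k × Linked _<_ (lo ∷ xs) × All (Shape q) xs ×
    recipNumerator xs * d ≡ p * recipDenominator xs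

  shapesFrom-sound : ∀ fuel b M {x} → x ∈ shapesFrom fuel b M → Shape q x
  shapesFrom-sound (suc fuel) b M m with q ^ b ≤? M
  shapesFrom-sound (suc fuel) b M (here refl) | yes _ = 0 , b , z≤n , refl
  shapesFrom-sound (suc fuel) b M (there (here refl)) | yes _ = 1 , b , s≤s z≤n , refl
  shapesFrom-sound (suc fuel) b M (there (there (here refl))) | yes _ = 2 , b , s≤s (s≤s z≤n) , refl
  shapesFrom-sound (suc fuel) b M (there (there (there m))) | yes _ = shapesFrom-sound fuel (suc b) M m

  shapesUpTo-sound : ∀ {M x} → x ∈ shapesUpTo M → Shape q x
  shapesUpTo-sound {M} = shapesFrom-sound (suc M) 0 M

  candidates-sound : ∀ k lo p d {x} → x ∈ candidates k lo p d → Shape q x × FeasibleHead k lo p d x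
  candidates-sound k lo p d m
    with x∈shapes , feasible ← ∈-filter⁻ (feasibleHead? k lo p d) (∈-deduplicate⁻ _≟_ _ m)
    = shapesUpTo-sound {headBound k p d} x∈shapes , feasible

  expansions-sound : ∀ k lo p d {xs} → xs ∈ expansions k lo p d → Expansion k lo p d xs
  expansions-sound zero lo zero d (here refl) = refl , [-] , [] , refl
  expansions-sound (suc k) lo p d m
    with x , ys , refl , x∈ , ys∈ ← ∈-branch⁻ (candidates (suc k) lo p d)
                                        (λ x → expansions k x (p * x ∸ d) (d * x)) m
    with sx , lo<x , d≤px , _ ← candidates-sound (suc k) lo p d x∈
    with len , lk , sys , eq ← expansions-sound k x (p * x ∸ d) (d * x) ys∈
    = cong suc len , lo<x ∷ lk , sx ∷ sys , from (recipSum-∷-≡⇔ p d ys 0<x d≤px) eq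
    where 0<x = <-≤-trans (s≤s z≤n) lo<x

  expansions-unique : ∀ k lo p d → Unique (expansions k lo p d)
  expansions-unique zero lo zero d = [] AllPairs.∷ AllPairs.[]
  expansions-unique zero lo (suc p) d = AllPairs.[]
  expansions-unique (suc k) lo p d =
    branch-unique {cs = candidates (suc k) lo p d} (deduplicate-! _)
      (λ x → expansions-unique k x (p * x ∸ d) (d * x))

  module _ (2≤q : 2 ≤ q) where

    private instance
      q≢0 : NonZero q
      q≢0 = >-nonZero (<-≤-trans (s≤s z≤n) 2≤q)

    shapesFrom-complete : ∀ fuel b e M {a} → b ≤ e → e ∸ b < fuel → q ^ e ≤ M → a ≤ 2 →
                          2 ^ a * q ^ e ∈ shapesFrom fuel b M
    shapesFrom-complete (suc fuel) b e M b≤e e∸b<fuel qᵉ≤M a≤2 with q ^ b ≤? M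
    ... | no qᵇ≰M = ⊥-elim (qᵇ≰M (≤-trans (^-monoʳ-≤ q b≤e) qᵉ≤M))
    ... | yes _ with m≤n⇒m<n∨m≡n b≤e
    ...   | inj₂ refl = ∈-powersOf2* a≤2
    ...   | inj₁ b<e = there (there (there (shapesFrom-complete fuel (suc b) e M b<e
              (<-≤-trans (∸-monoʳ-< (n<1+n b) b<e) (s≤s⁻¹ e∸b<fuel)) qᵉ≤M a≤2)))

    shapesUpTo-complete : ∀ {M x} → Shape q x → x ≤ M → x ∈ shapesUpTo M
    shapesUpTo-complete {M} (a , b , a≤2 , refl) x≤M =
      shapesFrom-complete (suc M) 0 b M z≤n (s≤s b≤M) qᵇ≤M a≤2
      where
      qᵇ≤M = ≤-trans (m≤n*m (q ^ b) (2 ^ a) {{m^n≢0 2 a}}) x≤M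
      b≤M = ≤-trans (<⇒≤ (n<m^n b 2≤q)) qᵇ≤M

    shape? : ∀ x → Dec (Shape q x)
    shape? x = map′ shapesUpTo-sound (λ s → shapesUpTo-complete s ≤-refl) (x ∈? shapesUpTo x)

    ≤-headBound : ∀ k p d {x} → 0 < d → d ≤ p * x → p * x ≤ k * d → x ≤ headBound k p d
    ≤-headBound k zero d 0<d d≤0 _ = ⊥-elim (<⇒≱ 0<d d≤0)
    ≤-headBound k (suc p) d {x} _ _ px≤kd = begin
      x                  ≡⟨ m*n/n≡m x (suc p) ⟨
      x * suc p / suc p  ≤⟨ /-monoˡ-≤ (suc p) (subst (_≤ k * d) (*-comm (suc p) x) px≤kd) ⟩
      k * d / suc p      ∎
      where open ≤-Reasoning

    candidates-complete : ∀ k lo p d {x} → 0 < d → Shape q x → FeasibleHead k lo p d x →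
                          x ∈ candidates k lo p d
    candidates-complete k lo p d 0<d sx feasible@(_ , d≤px , px≤kd) =
      ∈-deduplicate⁺ _≟_ (∈-filter⁺ (feasibleHead? k lo p d)
        (shapesUpTo-complete sx (≤-headBound k p d 0<d d≤px px≤kd)) feasible)

    expansions-complete : ∀ k lo p d {xs} → 0 < d → Expansion k lo p d xs → xs ∈ expansions k lo p d
    expansions-complete zero lo zero d {[]} _ _ = here refl
    expansions-complete zero lo (suc p) d {[]} _ (_ , _ , _ , ())
    expansions-complete (suc k) lo p d {x ∷ ys} 0<d (len , lo<x ∷ lk , sx ∷ sys , eq) =
      ∈-branch⁺ x∈candidates (expansions-complete k x (p * x ∸ d) (d * x) (*-mono-< 0<d 0<x)
        (suc-injective len , lk , sys , to (recipSum-∷-≡⇔ p d ys 0<x d≤px) eq))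
      where
      0<x = shape⇒pos sx
      d≤px : d ≤ p * x
      d≤px = recipSum-∷-lower p d ys 0<x eq
      px≤kd : p * x ≤ suc k * d
      px≤kd = subst (λ n → p * x ≤ n * d) len (recipSum-∷-upper p d ys 0<x lk eq)
      x∈candidates : x ∈ candidates (suc k) lo p d
      x∈candidates = candidates-complete (suc k) lo p d 0<d sx (lo<x , d≤px , px≤kd)

recipSum-∷<2/x : ∀ {x} xs → 0 < x → recipNumerator xs * x < recipDenominator xs →
  recipNumerator (x ∷ xs) * x < 2 * recipDenominator (x ∷ xs)
recipSum-∷<2/x {x} xs 0<x Nx<D = begin-strict
  recipNumerator (x ∷ xs) * x    ≡⟨ cong (_* x) (recipNumerator-∷ xs 0<x) ⟩
  (D + N * x) * x                <⟨ *-monoˡ-< x (+-monoʳ-< D Nx<D) ⟩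
  (D + D) * x                    ≡⟨ double D x ⟩
  2 * (x * D)                    ≡⟨ cong (2 *_) (recipDenominator-∷ xs 0<x) ⟨
  2 * recipDenominator (x ∷ xs)  ∎
  where
  open ≤-Reasoning
  instance _ = >-nonZero 0<x
  N = recipNumerator xs
  D = recipDenominator xs
  double : ∀ D x → (D + D) * x ≡ 2 * (x * D)
  double = solve-∀

recipSum<2/head : ∀ {x} xs → 0 < x → Linked (λ a b → 2 * a ≤ b) (x ∷ xs) →
  recipNumerator (x ∷ xs) * x < 2 * recipDenominator (x ∷ xs)
recipSum<2/head [] 0<x _ = recipSum-∷<2/x [] 0<x (s≤s z≤n)
recipSum<2/head {x} (y ∷ zs) 0<x (2x≤y ∷ doubling) = recipSum-∷<2/x (y ∷ zs) 0<x
  (*-cancelˡ-< 2 (N * x) D (begin-strict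
    2 * (N * x)  ≡⟨ swap N x ⟩
    N * (2 * x)  ≤⟨ *-monoʳ-≤ N 2x≤y ⟩
    N * y        <⟨ recipSum<2/head zs 0<y doubling ⟩
    2 * D        ∎))
  where
  open ≤-Reasoning
  N = recipNumerator (y ∷ zs)
  D = recipDenominator (y ∷ zs)
  0<y = <-≤-trans (*-monoʳ-< 2 0<x) 2x≤y
  swap : ∀ N x → 2 * (N * x) ≡ N * (2 * x)
  swap = solve-∀

recipSum-doubling≢1 : ∀ {x y zs} → 0 < x → Linked (λ a b → 2 * a ≤ b) (x ∷ y ∷ zs) →
  recipNumerator (x ∷ y ∷ zs) ≢ recipDenominator (x ∷ y ∷ zs)
recipSum-doubling≢1 {suc zero} {y} {zs} _ (2≤y ∷ _) eq =
  <⇒≢ (recipNumerator-pos zs (<-≤-trans (s≤s z≤n) 2≤y)) (sym N≡0)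
  where
  N≡0 : recipNumerator (y ∷ zs) ≡ 0
  N≡0 = trans (sym (*-identityʳ _)) (+-cancelˡ-≡ (recipDenominator (y ∷ zs)) _ 0 eq)
recipSum-doubling≢1 {x@(suc (suc _))} {y} {zs} 0<x doubling eq =
  <⇒≱ (recipSum<2/head (y ∷ zs) 0<x doubling) (begin
    2 * recipDenominator S  ≡⟨ *-comm 2 _ ⟩
    recipDenominator S * 2  ≤⟨ *-monoʳ-≤ (recipDenominator S) (s≤s (s≤s z≤n)) ⟩
    recipDenominator S * x  ≡⟨ cong (_* x) eq ⟨
    recipNumerator S * x    ∎)
  where
  open ≤-Reasoning
  S = x ∷ y ∷ zs

module _ {q} (8≤q : 8 ≤ q) where

  private instance
    q≢0 : NonZero q
    q≢0 = >-nonZero (<-≤-trans (s≤s z≤n) 8≤q)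

  2*shape≤q^suc : ∀ {a} b → a ≤ 2 → 2 * (2 ^ a * q ^ b) ≤ q ^ suc b
  2*shape≤q^suc {a} b a≤2 = begin
    2 * (2 ^ a * q ^ b)  ≡⟨ *-assoc 2 (2 ^ a) (q ^ b) ⟨
    2 ^ suc a * q ^ b    ≤⟨ *-monoˡ-≤ (q ^ b) (^-monoʳ-≤ 2 (s≤s a≤2)) ⟩
    8 * q ^ b            ≤⟨ *-monoˡ-≤ (q ^ b) 8≤q ⟩
    q ^ suc b            ∎
    where open ≤-Reasoning

  -- q ≥ 8 beats the factor 2^a ≤ 4, so shapes are ordered by their power of q first
  shape-gap : ∀ {x y} → Shape q x → Shape q y → x < y → 2 * x ≤ y
  shape-gap (a , b , a≤2 , refl) (c , e , c≤2 , refl) x<y with <-cmp b e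
  ... | tri< b<e _ _ = begin
    2 * (2 ^ a * q ^ b)  ≤⟨ 2*shape≤q^suc b a≤2 ⟩
    q ^ suc b            ≤⟨ ^-monoʳ-≤ q b<e ⟩
    q ^ e                ≤⟨ m≤n*m (q ^ e) (2 ^ c) {{m^n≢0 2 c}} ⟩
    2 ^ c * q ^ e        ∎
    where open ≤-Reasoning
  ... | tri≈ _ refl _ = begin
    2 * (2 ^ a * q ^ b)  ≡⟨ *-assoc 2 (2 ^ a) (q ^ b) ⟨
    2 ^ suc a * q ^ b    ≤⟨ *-monoˡ-≤ (q ^ b) (^-monoʳ-≤ 2 a<c) ⟩
    2 ^ c * q ^ b        ∎
    where
    open ≤-Reasoning
    a<c : a < c
    a<c = ≰⇒> (λ c≤a → <⇒≱ (*-cancelʳ-< (q ^ b) (2 ^ a) (2 ^ c) x<y) (^-monoʳ-≤ 2 c≤a))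
  ... | tri> _ _ e<b = ⊥-elim (<⇒≱ x<y (begin
    2 ^ c * q ^ e        ≤⟨ m≤n*m (2 ^ c * q ^ e) 2 ⟩
    2 * (2 ^ c * q ^ e)  ≤⟨ 2*shape≤q^suc e c≤2 ⟩
    q ^ suc e            ≤⟨ ^-monoʳ-≤ q e<b ⟩
    q ^ b                ≤⟨ m≤n*m (q ^ b) (2 ^ a) {{m^n≢0 2 a}} ⟩
    2 ^ a * q ^ b        ∎))
    where open ≤-Reasoning

  shapes-doubling : ∀ {xs} → All (Shape q) xs → Linked _<_ xs → Linked (λ a b → 2 * a ≤ b) xs
  shapes-doubling [] [] = []
  shapes-doubling (_ ∷ []) [-] = [-]
  shapes-doubling (sx ∷ sys@(sy ∷ _)) (x<y ∷ lk) = shape-gap sx sy x<y ∷ shapes-doubling sys lk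

  ¬admissibleWith-≥8 : ∀ {n S} → 2 ≤ n → ¬ AdmissibleWith q n S
  ¬admissibleWith-≥8 {S = []} () (refl , _)
  ¬admissibleWith-≥8 {S = _ ∷ []} (s≤s ()) (refl , _)
  ¬admissibleWith-≥8 {S = x ∷ y ∷ zs} _ (_ , lk , sum≡1 , _ , _ , shapes@(sx ∷ _)) =
    recipSum-doubling≢1 (shape⇒pos sx) (shapes-doubling shapes lk)
      (to (recipSum≡1⇔ (x ∷ y ∷ zs)) sum≡1)

oddPrime-cases : ∀ {q} → Prime q → q % 2 ≡ 1 → q ≡ 3 ⊎ q ≡ 5 ⊎ q ≡ 7 ⊎ 8 ≤ q
oddPrime-cases {0} _ ()
oddPrime-cases {1} p _ = ⊥-elim (¬prime[1] p)
oddPrime-cases {2} _ ()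
oddPrime-cases {3} _ _ = inj₁ refl
oddPrime-cases {4} _ ()
oddPrime-cases {5} _ _ = inj₂ (inj₁ refl)
oddPrime-cases {6} _ ()
oddPrime-cases {7} _ _ = inj₂ (inj₂ (inj₁ refl))
oddPrime-cases {suc (suc (suc (suc (suc (suc (suc (suc _)))))))} _ _ = inj₂ (inj₂ (inj₂ (m≤m+n 8 _)))

admissibleSetsWith : ℕ → ℕ → List (List ℕ)
admissibleSetsWith q n = Search.expansions q n 0 1 1

admissibleSetsWith-shapes : ∀ q n {S} → S ∈ admissibleSetsWith q n → All (Shape q) S
admissibleSetsWith-shapes q n m = proj₁ (proj₂ (proj₂ (Search.expansions-sound q n 0 1 1 m)))

admissibleSetsWith-sound : ∀ {q n S} → Prime q → q % 2 ≡ 1 →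
                           S ∈ admissibleSetsWith q n → AdmissibleWith q n S
admissibleSetsWith-sound {q} {n} {S} pq odd m
  with len , 0∷S , shapes , eq ← Search.expansions-sound q n 0 1 1 m
  = len , Linked.tail 0∷S , sum≡1 , pq , odd , shapes
  where
  sum≡1 : recipSum S ≡ 1ℚ
  sum≡1 = from (recipSum≡1⇔ S) (trans (sym (*-identityʳ _)) (trans eq (*-identityˡ _)))

admissibleSetsWith-complete : ∀ {q n S} → AdmissibleWith q n S → S ∈ admissibleSetsWith q n
admissibleSetsWith-complete {q} {n} {S} (len , lk , sum≡1 , pq , _ , shapes) =
  Search.expansions-complete q 2≤q n 0 1 1 (s≤s z≤n) (len , 0∷ shapes lk , shapes , eq)
  where
  2≤q = nonTrivial⇒n>1 q {{prime⇒nonTrivial pq}}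
  instance _ = >-nonZero (<-≤-trans (s≤s z≤n) 2≤q)
  0∷ : ∀ {xs} → All (Shape q) xs → Linked _<_ xs → Linked _<_ (0 ∷ xs)
  0∷ [] _ = [-]
  0∷ (sx ∷ _) lk = shape⇒pos sx ∷ lk
  eq : recipNumerator S * 1 ≡ 1 * recipDenominator S
  eq = trans (*-identityʳ _) (trans (to (recipSum≡1⇔ S) sum≡1) (sym (*-identityˡ _)))

∈-optional⁻ : ∀ {A : Set} b {x y : A} → x ∈ (if b then y ∷ [] else []) →
              if b then x ≡ y else ⊥
∈-optional⁻ true (here x≡y) = x≡y

module Census (n : ℕ) (hasV : Bool) (2≤n : 2 ≤ n)
  (with5 : admissibleSetsWith 5 n ≡ U n ∷ [])
  (with7 : admissibleSetsWith 7 n ≡ (if hasV then V n ∷ [] else []))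
  (5∈U : 5 ∈ U n) (7∈V : 7 ∈ V n)
  where

  private
    sets : ℕ → List (List ℕ)
    sets q = admissibleSetsWith q n

    shapesOf : ∀ q {S} → S ∈ sets q → All (Shape q) S
    shapesOf q = admissibleSetsWith-shapes q n

    complete : ∀ {q S} → AdmissibleWith q n S → S ∈ sets q
    complete = admissibleSetsWith-complete

    prime₃ = from-yes (prime? 3)
    prime₅ = from-yes (prime? 5)
    prime₇ = from-yes (prime? 7)

    ¬shape[3,5] = from-no (Search.shape? 3 (s≤s (s≤s z≤n)) 5)
    ¬shape[3,7] = from-no (Search.shape? 3 (s≤s (s≤s z≤n)) 7)
    ¬shape[7,5] = from-no (Search.shape? 7 (s≤s (s≤s z≤n)) 5)

  admissibleSets : List (List ℕ)
  admissibleSets = sets 3 ++ sets 5 ++ sets 7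

  ∈⇒admissible : ∀ {S} → S ∈ admissibleSets → Admissible n S
  ∈⇒admissible m with ∈-++⁻ (sets 3) m
  ... | inj₁ m₃ = 3 , admissibleSetsWith-sound prime₃ refl m₃
  ... | inj₂ m₅₇ with ∈-++⁻ (sets 5) m₅₇
  ...   | inj₁ m₅ = 5 , admissibleSetsWith-sound prime₅ refl m₅
  ...   | inj₂ m₇ = 7 , admissibleSetsWith-sound prime₇ refl m₇

  admissible⇒∈ : ∀ {S} → Admissible n S → S ∈ admissibleSets
  admissible⇒∈ (q , adm@(_ , _ , _ , pq , odd , _)) with oddPrime-cases pq odd
  ... | inj₁ refl = ∈-++⁺ˡ (complete adm)
  ... | inj₂ (inj₁ refl) = ∈-++⁺ʳ (sets 3) (∈-++⁺ˡ (complete adm))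
  ... | inj₂ (inj₂ (inj₁ refl)) = ∈-++⁺ʳ (sets 3) (∈-++⁺ʳ (sets 5) (complete adm))
  ... | inj₂ (inj₂ (inj₂ 8≤q)) = ⊥-elim (¬admissibleWith-≥8 8≤q 2≤n adm)

  5∈ : ∀ {S} → S ∈ sets 5 → 5 ∈ S
  5∈ m with subst (_ ∈_) with5 m
  ... | here refl = 5∈U

  7∈ : ∀ {S} → S ∈ sets 7 → 7 ∈ S
  7∈ {S} m = 7∈optional hasV (subst (S ∈_) with7 m)
    where
    7∈optional : ∀ b → S ∈ (if b then V n ∷ [] else []) → 7 ∈ S
    7∈optional true (here refl) = 7∈V

  admissibleSets-unique : Unique admissibleSets
  admissibleSets-unique = ++⁺ (unique 3) (++⁺ (unique 5) (unique 7) disjoint₅₇) disjoint₃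
    where
    unique : ∀ q → Unique (sets q)
    unique q = Search.expansions-unique q n 0 1 1
    disjoint₅₇ : Disjoint (sets 5) (sets 7)
    disjoint₅₇ (m₅ , m₇) = ¬shape[7,5] (lookup (shapesOf 7 m₇) (5∈ m₅))
    disjoint₃ : Disjoint (sets 3) (sets 5 ++ sets 7)
    disjoint₃ (m₃ , m₅₇) with ∈-++⁻ (sets 5) m₅₇
    ... | inj₁ m₅ = ¬shape[3,5] (lookup (shapesOf 3 m₃) (5∈ m₅))
    ... | inj₂ m₇ = ¬shape[3,7] (lookup (shapesOf 3 m₃) (7∈ m₇))

  U-admissible : Admissible n (U n)
  U-admissible = 5 , admissibleSetsWith-sound prime₅ refl (subst (U n ∈_) (sym with5) (here refl))

  V-admissible : if hasV then Admissible n (V n) else ⊤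
  V-admissible = admissibleIf hasV with7
    where
    admissibleIf : ∀ b → sets 7 ≡ (if b then V n ∷ [] else []) → if b then Admissible n (V n) else ⊤
    admissibleIf true with7 =
      7 , admissibleSetsWith-sound prime₇ refl (subst (V n ∈_) (sym with7) (here refl))
    admissibleIf false _ = tt

  ¬3⇒U⊎V : ∀ {S} → Admissible n S → ¬ AdmissibleWith 3 n S →
           S ≡ U n ⊎ (if hasV then S ≡ V n else ⊥)
  ¬3⇒U⊎V (q , adm@(_ , _ , _ , pq , odd , _)) ¬3 with oddPrime-cases pq odd
  ... | inj₁ refl = ⊥-elim (¬3 adm)
  ... | inj₂ (inj₁ refl) = inj₁ (∈-optional⁻ true (subst (_ ∈_) with5 (complete adm)))
  ... | inj₂ (inj₂ (inj₁ refl)) = inj₂ (∈-optional⁻ hasV (subst (_ ∈_) with7 (complete adm)))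
  ... | inj₂ (inj₂ (inj₂ 8≤q)) = ⊥-elim (¬admissibleWith-≥8 8≤q 2≤n adm)

  claim : ∀ {total with3} → length (sets 3) ≡ with3 → length admissibleSets ≡ total →
          Claim n total with3 hasV
  claim len₃ len =
    (admissibleSets , len , admissibleSets-unique , λ _ → mk⇔ ∈⇒admissible admissible⇒∈) ,
    (sets 3 , len₃ , Search.expansions-unique 3 n 0 1 1 ,
      λ _ → mk⇔ (admissibleSetsWith-sound prime₃ refl) complete) ,
    U-admissible , V-admissible , λ _ → ¬3⇒U⊎V

theorem3 : Claim 10 101 100 false × Claim 11 192 190 true × Claim 12 363 362 false × Claim 13 692 690 true
theorem3 =
  Census.claim 10 false 2≤n refl refl third third refl refl ,
  Census.claim 11 true  2≤n refl refl third third refl refl ,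
  Census.claim 12 false 2≤n refl refl third third refl refl ,
  Census.claim 13 true  2≤n refl refl third third refl refl
  where
  2≤n : ∀ {n} → 2 ≤ 2 + n
  2≤n = s≤s (s≤s z≤n)
  third : ∀ {x y z : ℕ} {zs} → z ∈ x ∷ y ∷ z ∷ zs
  third = there (there (here refl))
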